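{- For every graph $G$, the graph $\overline{L(G)}$ is $\mathcal{O}_2$-free.
   Context: All graphs are finite, simple and undirected. $L(G)$ is the line graph of $G$ and $\overline{H}$ the complement. Two cycles $C$, $C'$ in a graph are independent if they are vertex-disjoint and there is no edge between $V(C)$ and $V(C')$. A graph is $\mathcal{O}_k$-free if it does not contain $k$ pairwise independent cycles. -}

module Defs where

open import Data.Nat using (ℕ; suc; _<_)
open import Data.Fin using (Fin; zero; suc; inject₁; fromℕ; toℕ)
open import Data.Fin.Properties using ()
open import Data.Bool using (Bool; true; false)
open import Data.Product using (Σ; _×_; _,_; proj₁; proj₂)
open import Data.Sum using (_⊎_)
open import Data.Empty using (⊥)
open import Relation.Nullary using (¬_)
open import Relation.Binary.PropositionalEquality using (_≡_; _≢_)
open import Function.Definitions using (Injective)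

record FinGraph (n : ℕ) : Set where
  field
    adj    : Fin n → Fin n → Bool
    sym    : ∀ i j → adj i j ≡ adj j i
    irrefl : ∀ i → adj i i ≡ false

record Graph (V : Set) : Set₁ where
  field
    Adj    : V → V → Set
    sym    : ∀ {u v} → Adj u v → Adj v u
    irrefl : ∀ {v} → ¬ Adj v v

open Graph public

-- Edges of G: pairs (i , j) with toℕ i < toℕ j and i ~ j (one per edge).
Edge : ∀ {n} → FinGraph n → Set
Edge {n} G = Σ (Fin n × Fin n) λ p →
  (toℕ (proj₁ p) < toℕ (proj₂ p)) × (FinGraph.adj G (proj₁ p) (proj₂ p) ≡ true)

endpoint₁ endpoint₂ : ∀ {n} (G : FinGraph n) → Edge G → Fin n
endpoint₁ G e = proj₁ (proj₁ e)
endpoint₂ G e = proj₂ (proj₁ e)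

ShareEnd : ∀ {n} {G : FinGraph n} → Edge G → Edge G → Set
ShareEnd {G = G} e f =
  (endpoint₁ G e ≡ endpoint₁ G f) ⊎ (endpoint₁ G e ≡ endpoint₂ G f) ⊎
  (endpoint₂ G e ≡ endpoint₁ G f) ⊎ (endpoint₂ G e ≡ endpoint₂ G f)

LineGraph : ∀ {n} (G : FinGraph n) → Graph (Edge G)
LineGraph G = record
  { Adj    = λ e f → (e ≢ f) × ShareEnd {G = G} e f
  ; sym    = λ { {e} {f} (ne , s) → (λ q → ne (Relation.Binary.PropositionalEquality.sym q)) , symS {e} {f} s }
  ; irrefl = λ { (ne , _) → ne Relation.Binary.PropositionalEquality.refl }
  }
  where
  open Data.Sum using (inj₁; inj₂)
  open Relation.Binary.PropositionalEquality using () renaming (sym to ≡sym)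
  symS : ∀ {e f} → ShareEnd {G = G} e f → ShareEnd {G = G} f e
  symS (inj₁ p) = inj₁ (≡sym p)
  symS (inj₂ (inj₁ p)) = inj₂ (inj₂ (inj₁ (≡sym p)))
  symS (inj₂ (inj₂ (inj₁ p))) = inj₂ (inj₁ (≡sym p))
  symS (inj₂ (inj₂ (inj₂ p))) = inj₂ (inj₂ (inj₂ (≡sym p)))

Complement : ∀ {V} → Graph V → Graph V
Complement H = record
  { Adj    = λ u v → (u ≢ v) × ¬ Adj H u v
  ; sym    = λ { (ne , na) → (λ q → ne (Relation.Binary.PropositionalEquality.sym q))
                            , (λ a → na (Graph.sym H a)) }
  ; irrefl = λ { (ne , _) → ne Relation.Binary.PropositionalEquality.refl }
  }

-- A cycle in H: k = m + 3 ≥ 3 pairwise distinct vertices v₀ … v_{k-1}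
-- with v_i ~ v_{i+1} and v_{k-1} ~ v₀.
record Cycle {V : Set} (H : Graph V) : Set where
  field
    m      : ℕ
    vert   : Fin (suc (suc (suc m))) → V
    inj    : Injective _≡_ _≡_ vert
    step   : ∀ (i : Fin (suc (suc m))) → Adj H (vert (inject₁ i)) (vert (suc i))
    close  : Adj H (vert (fromℕ (suc (suc m)))) (vert zero)

Independent : ∀ {V} {H : Graph V} → Cycle H → Cycle H → Set
Independent {H = H} C D =
  ∀ i j → (Cycle.vert C i ≢ Cycle.vert D j) × ¬ Adj H (Cycle.vert C i) (Cycle.vert D j)

O₂-free : ∀ {V} → Graph V → Set
O₂-free H = ¬ (Σ (Cycle H) λ C → Σ (Cycle H) λ D → Independent {H = H} C D)

-- Take independent cycles e₀ e₁ e₂ … and f₀ f₁ … of the complement of L(G).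
-- Independence means every eᵢ shares an endpoint with every fⱼ, while
-- consecutive vertices of a cycle are disjoint edges of G.  The edge f₀ meets
-- the disjoint edges e₀ and e₁ at its two different endpoints, so e₂, being
-- disjoint from e₁, meets f₀ where e₀ does; likewise for f₁.  As f₀ and f₁ are
-- disjoint, e₀ and e₂ then have two common endpoints, so e₀ = e₂, contradicting
-- that a cycle has distinct vertices.
module Submission where

open import Defs hiding (sym)
open import Data.Nat using (ℕ; suc; _<_)
open import Data.Nat.Properties using (<-irrelevant; <-asym)
open import Data.Fin using (Fin; zero; suc; toℕ; inject₁)
open import Data.Fin.Patterns using (0F; 1F; 2F)
import Data.Bool as Bool
open import Data.Product using (∃; _×_; _,_; proj₁; proj₂; uncurry)
open import Data.Sum using (inj₁; inj₂)
open import Data.Empty using (⊥-elim)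
open import Relation.Nullary using (¬_)
open import Relation.Binary.PropositionalEquality
open import Axiom.UniquenessOfIdentityProofs using (module Decidable⇒UIP)

module _ {n : ℕ} (G : FinGraph n) where

  infix 4 _∈ₑ_ _⌢_

  private
    _⌢_ : Edge G → Edge G → Set
    e ⌢ f = ShareEnd {G = G} e f

  data _∈ₑ_ (x : Fin n) (e : Edge G) : Set where
    end₁ : x ≡ endpoint₁ G e → x ∈ₑ e
    end₂ : x ≡ endpoint₂ G e → x ∈ₑ e

  ShareEnd⇒common : ∀ (e f : Edge G) → e ⌢ f → ∃ λ x → x ∈ₑ e × x ∈ₑ f
  ShareEnd⇒common e f (inj₁ p)                = endpoint₁ G e , end₁ refl , end₁ p
  ShareEnd⇒common e f (inj₂ (inj₁ p))         = endpoint₁ G e , end₁ refl , end₂ p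
  ShareEnd⇒common e f (inj₂ (inj₂ (inj₁ p))) = endpoint₂ G e , end₂ refl , end₁ p
  ShareEnd⇒common e f (inj₂ (inj₂ (inj₂ p))) = endpoint₂ G e , end₂ refl , end₂ p

  common⇒ShareEnd : ∀ {e f : Edge G} {x} → x ∈ₑ e → x ∈ₑ f → e ⌢ f
  common⇒ShareEnd (end₁ p) (end₁ q) = inj₁ (trans (sym p) q)
  common⇒ShareEnd (end₁ p) (end₂ q) = inj₂ (inj₁ (trans (sym p) q))
  common⇒ShareEnd (end₂ p) (end₁ q) = inj₂ (inj₂ (inj₁ (trans (sym p) q)))
  common⇒ShareEnd (end₂ p) (end₂ q) = inj₂ (inj₂ (inj₂ (trans (sym p) q)))

  disjoint⇒distinct-ends : ∀ {e f : Edge G} {x y} →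
    ¬ e ⌢ f → x ∈ₑ e → y ∈ₑ f → x ≢ y
  disjoint⇒distinct-ends ¬s x∈e y∈f refl = ¬s (common⇒ShareEnd x∈e y∈f)

  endpoints-injective : ∀ {e f : Edge G} →
    endpoint₁ G e ≡ endpoint₁ G f → endpoint₂ G e ≡ endpoint₂ G f → e ≡ f
  endpoints-injective {(a , b) , a<b , ab} {(.a , .b) , a<b′ , ab′} refl refl
    rewrite <-irrelevant a<b a<b′
          | Decidable⇒UIP.≡-irrelevant Bool._≟_ ab ab′ = refl

  endpoint₁<endpoint₂ : (e : Edge G) → toℕ (endpoint₁ G e) < toℕ (endpoint₂ G e)
  endpoint₁<endpoint₂ e = proj₁ (proj₂ e)

  -- The crossed cases are impossible because endpoints are stored in increasing order.
  edge-determined-by-two-ends : ∀ {e f : Edge G} {x y} → x ≢ y →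
    x ∈ₑ e → y ∈ₑ e → x ∈ₑ f → y ∈ₑ f → e ≡ f
  edge-determined-by-two-ends x≢y (end₁ p) (end₁ q) _ _ = ⊥-elim (x≢y (trans p (sym q)))
  edge-determined-by-two-ends x≢y (end₂ p) (end₂ q) _ _ = ⊥-elim (x≢y (trans p (sym q)))
  edge-determined-by-two-ends x≢y _ _ (end₁ p) (end₁ q) = ⊥-elim (x≢y (trans p (sym q)))
  edge-determined-by-two-ends x≢y _ _ (end₂ p) (end₂ q) = ⊥-elim (x≢y (trans p (sym q)))
  edge-determined-by-two-ends _ (end₁ p) (end₂ q) (end₁ p′) (end₂ q′) =
    endpoints-injective (trans (sym p) p′) (trans (sym q) q′)
  edge-determined-by-two-ends _ (end₂ p) (end₁ q) (end₂ p′) (end₁ q′) =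
    endpoints-injective (trans (sym q) q′) (trans (sym p) p′)
  edge-determined-by-two-ends {e} {f} _ (end₁ p) (end₂ q) (end₂ p′) (end₁ q′) =
    ⊥-elim (<-asym (endpoint₁<endpoint₂ e)
      (subst₂ (λ u v → toℕ u < toℕ v) (trans (sym q′) q) (trans (sym p′) p) (endpoint₁<endpoint₂ f)))
  edge-determined-by-two-ends {e} {f} _ (end₂ p) (end₁ q) (end₁ p′) (end₂ q′) =
    ⊥-elim (<-asym (endpoint₁<endpoint₂ e)
      (subst₂ (λ u v → toℕ u < toℕ v) (trans (sym p′) p) (trans (sym q′) q) (endpoint₁<endpoint₂ f)))

  at-most-two-ends : ∀ {f : Edge G} {x y z} →
    x ∈ₑ f → y ∈ₑ f → z ∈ₑ f → x ≢ y → z ≢ y → z ≡ x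
  at-most-two-ends (end₁ p) (end₁ q) _ x≢y _ = ⊥-elim (x≢y (trans p (sym q)))
  at-most-two-ends (end₂ p) (end₂ q) _ x≢y _ = ⊥-elim (x≢y (trans p (sym q)))
  at-most-two-ends (end₁ p) (end₂ q) (end₁ r) _ _   = trans r (sym p)
  at-most-two-ends (end₁ p) (end₂ q) (end₂ r) _ z≢y = ⊥-elim (z≢y (trans r (sym q)))
  at-most-two-ends (end₂ p) (end₁ q) (end₂ r) _ _   = trans r (sym p)
  at-most-two-ends (end₂ p) (end₁ q) (end₁ r) _ z≢y = ⊥-elim (z≢y (trans r (sym q)))

  meets-path-at-common-end : ∀ (e₀ e₁ e₂ f : Edge G) →
    ¬ e₀ ⌢ e₁ → ¬ e₁ ⌢ e₂ → e₀ ⌢ f → e₁ ⌢ f → e₂ ⌢ f →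
    ∃ λ x → x ∈ₑ e₀ × x ∈ₑ e₂ × x ∈ₑ f
  meets-path-at-common-end e₀ e₁ e₂ f ¬s₀₁ ¬s₁₂ s₀ s₁ s₂
    with x , x∈e₀ , x∈f ← ShareEnd⇒common e₀ f s₀
       | y , y∈e₁ , y∈f ← ShareEnd⇒common e₁ f s₁
       | z , z∈e₂ , z∈f ← ShareEnd⇒common e₂ f s₂ =
    x , x∈e₀ , subst (_∈ₑ e₂) z≡x z∈e₂ , x∈f
    where
    z≡x : z ≡ x
    z≡x = at-most-two-ends x∈f y∈f z∈f
            (disjoint⇒distinct-ends ¬s₀₁ x∈e₀ y∈e₁)
            (≢-sym (disjoint⇒distinct-ends ¬s₁₂ y∈e₁ z∈e₂))

  path-joined-to-disjoint-pair⇒ends-equal : ∀ (e₀ e₁ e₂ f₀ f₁ : Edge G) →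
    ¬ e₀ ⌢ e₁ → ¬ e₁ ⌢ e₂ → ¬ f₀ ⌢ f₁ →
    e₀ ⌢ f₀ → e₁ ⌢ f₀ → e₂ ⌢ f₀ →
    e₀ ⌢ f₁ → e₁ ⌢ f₁ → e₂ ⌢ f₁ →
    e₀ ≡ e₂
  path-joined-to-disjoint-pair⇒ends-equal e₀ e₁ e₂ f₀ f₁ ¬s₀₁ ¬s₁₂ ¬sf s₀₀ s₁₀ s₂₀ s₀₁ s₁₁ s₂₁
    with x₀ , x₀∈e₀ , x₀∈e₂ , x₀∈f₀ ← meets-path-at-common-end e₀ e₁ e₂ f₀ ¬s₀₁ ¬s₁₂ s₀₀ s₁₀ s₂₀
       | x₁ , x₁∈e₀ , x₁∈e₂ , x₁∈f₁ ← meets-path-at-common-end e₀ e₁ e₂ f₁ ¬s₀₁ ¬s₁₂ s₀₁ s₁₁ s₂₁ =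
    edge-determined-by-two-ends (disjoint⇒distinct-ends ¬sf x₀∈f₀ x₁∈f₁)
      x₀∈e₀ x₁∈e₀ x₀∈e₂ x₁∈e₂

  private
    H = Complement (LineGraph G)

  Complement-LineGraph-Adj⇒disjoint : ∀ {e f : Edge G} → Adj H e f → ¬ e ⌢ f
  Complement-LineGraph-Adj⇒disjoint (e≢f , ¬adj) s = ¬adj (e≢f , s)

  -- Only the double negation is available constructively; it suffices as the goal is ⊥.
  nonadjacent⇒¬¬ShareEnd : ∀ {e f : Edge G} → e ≢ f → ¬ Adj H e f → ¬ ¬ e ⌢ f
  nonadjacent⇒¬¬ShareEnd e≢f ¬adj ¬s = ¬adj (e≢f , λ adj → ¬s (proj₂ adj))

  consecutive-disjoint : (C : Cycle H) (i : Fin (suc (suc (Cycle.m C)))) →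
    ¬ Cycle.vert C (inject₁ i) ⌢ Cycle.vert C (suc i)
  consecutive-disjoint C i = Complement-LineGraph-Adj⇒disjoint (Cycle.step C i)

proposition3p4 : ∀ (n : ℕ) (G : FinGraph n) → O₂-free (Complement (LineGraph G))
proposition3p4 n G (C , D , independent) =
  joined 0F 0F λ s₀₀ → joined 1F 0F λ s₁₀ → joined 2F 0F λ s₂₀ →
  joined 0F 1F λ s₀₁ → joined 1F 1F λ s₁₁ → joined 2F 1F λ s₂₁ →
  0≢2 (Cycle.inj C
    (path-joined-to-disjoint-pair⇒ends-equal G (e 0F) (e 1F) (e 2F) (f 0F) (f 1F)
      (consecutive-disjoint G C 0F) (consecutive-disjoint G C 1F) (consecutive-disjoint G D 0F)
      s₀₀ s₁₀ s₂₀ s₀₁ s₁₁ s₂₁))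
  where
  e : Fin (suc (suc (suc (Cycle.m C)))) → Edge G
  e = Cycle.vert C
  f : Fin (suc (suc (suc (Cycle.m D)))) → Edge G
  f = Cycle.vert D
  joined : ∀ i j → ¬ ¬ ShareEnd {G = G} (e i) (f j)
  joined i j = uncurry (nonadjacent⇒¬¬ShareEnd G) (independent i j)
  0≢2 : ∀ {m} → zero ≢ Fin.suc {suc (suc m)} (suc zero)
  0≢2 ()
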